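{- Let $r\ge3$, $\ell\ge1$, $a\ge r-2$ be integers and $d=r-1$. Let $E=L\cup\{e,f\}\cup A$ be a disjoint union with $|L|=\ell$, $|A|=a$, and let $\mathcal{M}$ be the rank-$r$ matroid on $E$ whose bases are the $r$-subsets $B\subseteq E$ with $|B\cap(L\cup\{e,f\})|\le2$. Then $$\Delta M\{e,f\}=\sum_{k=0}^d\frac{1}{k+1}\binom{2k}{k}m_{[2d,d-k]}(A)+m_1(L)\sum_{k=1}^d\binom{2k-1}{k}m_{[2d-1,d-k]}(A)+\big(m_2(L)+m_{11}(L)\big)\sum_{k=0}^{d-1}\binom{2k}{k}m_{[2d-2,d-1-k]}(A).$$
   Context: Variables $\mathbf{y}=\{y_h:h\in E\}$; the basis enumerator is $M=\sum_B\prod_{h\in B}y_h$ over bases $B$. For distinct $e,f$ write uniquely $M=M^{ef}+y_eM_e^f+y_fM_f^e+y_ey_fM_{ef}$ with the four polynomials free of $y_e,y_f$; the Rayleigh difference is $\Delta M\{e,f\}=M_e^fM_f^e-M_{ef}M^{ef}$. For a finite set $X\subseteq E$ and integers $n,i$, $[n,i]$ denotes the integer partition $2^i1^{n-2i}$, and $m_{[n,i]}(X)$ is the monomial symmetric function in $\{y_h:h\in X\}$ of that shape: the sum of all monomials $\prod_{h\in X}y_h^{\alpha(h)}$ with $\alpha:X\to\{0,1,2\}$ taking value $2$ exactly $i$ times and value $1$ exactly $n-2i$ times (zero if no such $\alpha$ exists). Also $m_1(L)=\sum_{p\in L}y_p$, $m_2(L)=\sum_{p\in L}y_p^2$, $m_{11}(L)=\sum_{\{p,q\}\subseteq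 L,p\ne q}y_py_q$. -}

module Defs where

open import Level using (Level)
open import Data.Nat using (ℕ; zero; suc; _≤ᵇ_; _≡ᵇ_)
import Data.Nat as N
open import Data.Nat.Combinatorics using (_C_)
open import Data.Nat.DivMod using (_/_)
open import Data.Bool using (Bool; true; false; if_then_else_; _∧_)
open import Data.Fin using (Fin; zero; suc)
open import Data.Vec using (Vec; []; _∷_)
open import Data.List using (List; []; _∷_; map; concatMap; upTo; foldr)
open import Algebra.Bundles using (CommutativeRing)

allSubsets : (n : ℕ) → List (Vec Bool n)
allSubsets zero = [] ∷ []
allSubsets (suc n) = concatMap (λ s → (false ∷ s) ∷ (true ∷ s) ∷ []) (allSubsets n)

card : ∀ {n} → Vec Bool n → ℕ
card [] = 0
card (false ∷ s) = card s
card (true ∷ s) = suc (card s)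

bit : Bool → ℕ
bit false = 0
bit true = 1

allExps : (n : ℕ) → List (Vec ℕ n)
allExps zero = [] ∷ []
allExps (suc n) = concatMap (λ s → (0 ∷ s) ∷ (1 ∷ s) ∷ (2 ∷ s) ∷ []) (allExps n)

count : ∀ {n} → ℕ → Vec ℕ n → ℕ
count v [] = 0
count v (x ∷ s) = (if x ≡ᵇ v then 1 else 0) N.+ count v s

-- Catalan number  (1/(k+1)) * binom(2k,k)  (an exact division)
catalan : ℕ → ℕ
catalan k = ((2 N.* k) C k) / suc k

-- A subset B of E is
-- given by (SL , be , bf , SA): SL ⊆ L, be = [e ∈ B], bf = [f ∈ B], SA ⊆ A.
isBasis : (r : ℕ) {ℓ a : ℕ} → Vec Bool ℓ → Bool → Bool → Vec Bool a → Bool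
isBasis r SL be bf SA =
  ((card SL N.+ bit be N.+ bit bf N.+ card SA) ≡ᵇ r) ∧ ((card SL N.+ bit be N.+ bit bf) ≤ᵇ 2)

-- α has shape [n,i] = 2^i 1^{n-2i}: value 2 exactly i times, value 1 exactly
-- n-2i times (impossible when n < 2i)
shapeOK : ∀ {m} → Vec ℕ m → ℕ → ℕ → Bool
shapeOK α n i = (count 2 α ≡ᵇ i) ∧ ((count 1 α N.+ 2 N.* i) ≡ᵇ n)

module Poly {c ℓr : Level} (R : CommutativeRing c ℓr) where
  open CommutativeRing R using (Carrier; _+_; _*_; _-_; 0#; 1#)

  sumL : List Carrier → Carrier
  sumL = foldr _+_ 0#

  ι : ℕ → Carrier
  ι zero = 0#
  ι (suc n) = 1# + ι n

  pow : Carrier → ℕ → Carrier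
  pow x zero = 1#
  pow x (suc n) = x * pow x n

  prodSub : ∀ {n} → (Fin n → Carrier) → Vec Bool n → Carrier
  prodSub y [] = 1#
  prodSub y (false ∷ s) = prodSub (λ i → y (suc i)) s
  prodSub y (true ∷ s) = y zero * prodSub (λ i → y (suc i)) s

  monom : ∀ {n} → (Fin n → Carrier) → Vec ℕ n → Carrier
  monom y [] = 1#
  monom y (x ∷ α) = pow (y zero) x * monom (λ i → y (suc i)) α

  sumTo : ℕ → (ℕ → Carrier) → Carrier
  sumTo n f = sumL (map f (upTo (suc n)))

  sumFrom1To : ℕ → (ℕ → Carrier) → Carrier
  sumFrom1To n f = sumL (map (λ k → f (suc k)) (upTo n))

  -- monomial symmetric function m_{[n,i]}(X) = m_{2^i 1^{n-2i}} in the variables y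
  -- (α takes value 2 exactly i times and value 1 exactly n-2i times; zero if n < 2i)
  mSym : ∀ {m} → (Fin m → Carrier) → ℕ → ℕ → Carrier
  mSym {m} y n i =
    sumL (map (λ α → if shapeOK α n i then monom y α else 0#)
              (allExps m))

  m1 : ∀ {m} → (Fin m → Carrier) → Carrier
  m1 {m} y = sumL (map (λ S → if card S ≡ᵇ 1 then prodSub y S else 0#) (allSubsets m))

  m2 : ∀ {m} → (Fin m → Carrier) → Carrier
  m2 {m} y = sumL (map (λ S → if card S ≡ᵇ 1 then prodSub (λ p → y p * y p) S else 0#)
                       (allSubsets m))

  m11 : ∀ {m} → (Fin m → Carrier) → Carrier
  m11 {m} y = sumL (map (λ S → if card S ≡ᵇ 2 then prodSub y S else 0#) (allSubsets m))

  module Matroid (r : ℕ) {ℓ a : ℕ} (yL : Fin ℓ → Carrier) (ye yf : Carrier)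
                 (yA : Fin a → Carrier) where
    M : Carrier
    M = sumL (concatMap (λ SL → concatMap (λ SA → concatMap (λ be → map (λ bf →
          if isBasis r SL be bf SA
          then ((if be then ye else 1#) * (if bf then yf else 1#)) * (prodSub yL SL * prodSub yA SA)
          else 0#) (false ∷ true ∷ [])) (false ∷ true ∷ [])) (allSubsets a)) (allSubsets ℓ))

    -- The part of M with e ∈ B iff be and f ∈ B iff bf, with y_e, y_f removed.
    -- part false false = M^{ef}, part true false = M_e^f,
    -- part false true = M_f^e, part true true = M_{ef}; so that
    -- M = M^{ef} + y_e M_e^f + y_f M_f^e + y_e y_f M_{ef}.
    part : Bool → Bool → Carrier
    part be bf = sumL (concatMap (λ SL → map (λ SA →
        if isBasis r SL be bf SA then prodSub yL SL * prodSub yA SA else 0#)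
        (allSubsets a)) (allSubsets ℓ))

    ΔM : Carrier
    ΔM = part true false * part false true - part true true * part false false

module Submission where

open import Defs
open import Level using (Level)
open import Data.Nat using (ℕ; suc; _≤_; _∸_; s≤s)
open import Data.Nat as N using ()
open import Data.Nat.Combinatorics using (_C_)
open import Data.Fin using (Fin)
open import Algebra.Bundles using (CommutativeRing)

-- The parts of M are read off by counting how many elements of a basis lie in L:
-- M_e^f = M_f^e = e_d(A) + e_{d-1}(A) m₁(L), M_{ef} = e_{d-1}(A) and
-- M^{ef} = e_{d+1}(A) + e_d(A) m₁(L) + e_{d-1}(A) m₁₁(L), where e_k are the elementary
-- symmetric polynomials.  Hence ΔM = (e_d² − e_{d-1} e_{d+1}) + m₁ e_d e_{d-1} + (m₁² − m₁₁) e_{d-1}²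
-- with m₁² − m₁₁ = m₂ + m₁₁.  In a product e_p e_q a monomial with i squared and j simple variables
-- occurs C(j, p − i) times (choose which simple variables come from e_p), so each product is a
-- binomial combination of the m_{[p+q,i]}; in the first one C(2k,k) − C(2k,k−1) is the Catalan number.

module CatalanNumbers where
  open import Data.Nat
  open import Data.Nat.Properties
  open import Data.Nat.DivMod using (_/_; m*n/n≡m)
  open import Data.Nat.Combinatorics using (_C_; nCk+nC[k+1]≡[n+1]C[k+1]; nC1≡n)
  open import Data.Nat.Tactic.RingSolver using (solve-∀)
  open import Relation.Binary.PropositionalEquality
  open ≡-Reasoning

  C-absorption : ∀ n k → suc k * (n C suc k) + k * (n C k) ≡ n * (n C k)
  C-absorption zero    zero    = refl
  C-absorption zero    (suc k) = cong₂ _+_ (*-zeroʳ (2 + k)) (*-zeroʳ (suc k))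
  C-absorption (suc n) zero    = begin
    1 * (suc n C 1) + 0 ≡⟨ cong (λ x → 1 * x + 0) (nC1≡n (suc n)) ⟩
    1 * suc n + 0       ≡⟨ trans (+-identityʳ _) (*-comm 1 (suc n)) ⟩
    suc n * 1           ∎
  C-absorption (suc n) (suc k) = begin
    (2 + k) * (suc n C (2 + k)) + suc k * (suc n C suc k)
      ≡⟨ cong₂ (λ u v → (2 + k) * u + suc k * v) (pascal (suc k)) (pascal k) ⟨
    (2 + k) * (B + B′) + suc k * (A + B)
      ≡⟨ regroup k A B B′ ⟩
    ((2 + k) * B′ + suc k * B) + (suc k * B + k * A) + (A + B)
      ≡⟨ cong (λ u → u + (A + B)) (cong₂ _+_ (C-absorption n (suc k)) (C-absorption n k)) ⟩
    n * B + n * A + (A + B)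
      ≡⟨ collect n A B ⟩
    suc n * (A + B)
      ≡⟨ cong (suc n *_) (pascal k) ⟩
    suc n * (suc n C suc k) ∎
    where
    A = n C k
    B = n C suc k
    B′ = n C (2 + k)
    pascal : ∀ j → n C j + n C suc j ≡ suc n C suc j
    pascal = nCk+nC[k+1]≡[n+1]C[k+1] n
    regroup : ∀ k a b c → (2 + k) * (b + c) + suc k * (a + b) ≡ ((2 + k) * c + suc k * b) + (suc k * b + k * a) + (a + b)
    regroup = solve-∀
    collect : ∀ n a b → n * b + n * a + (a + b) ≡ suc n * (a + b)
    collect = solve-∀

  catalan-split : ∀ s → (2 * suc s) C suc s ≡ catalan (suc s) + (2 * suc s) C s
  catalan-split s = begin
    X             ≡⟨ m∸n+n≡m Y≤X ⟨
    X ∸ Y + Y     ≡⟨ cong (_+ Y) catalan≡X∸Y ⟨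
    catalan t + Y ∎
    where
    t = suc s
    X = (2 * t) C t
    Y = (2 * t) C s
    tX≡[1+t]Y : t * X ≡ suc t * Y
    tX≡[1+t]Y = +-cancelʳ-≡ (s * Y) (t * X) (suc t * Y) (begin
      t * X + s * Y      ≡⟨ C-absorption (2 * t) s ⟩
      2 * t * Y          ≡⟨ split s Y ⟩
      suc t * Y + s * Y  ∎)
      where
      split : ∀ s y → 2 * suc s * y ≡ (2 + s) * y + s * y
      split = solve-∀
    Y≤X : Y ≤ X
    Y≤X = *-cancelˡ-≤ t (≤-trans (m≤n+m (t * Y) Y) (≤-reflexive (sym tX≡[1+t]Y)))
    catalan≡X∸Y : catalan t ≡ X ∸ Y
    catalan≡X∸Y = begin
      X / suc t                 ≡⟨ cong (_/ suc t) (begin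
        X                       ≡⟨ m+n∸n≡m X (t * X) ⟨
        X + t * X ∸ t * X       ≡⟨ cong (suc t * X ∸_) tX≡[1+t]Y ⟩
        suc t * X ∸ suc t * Y   ≡⟨ *-distribˡ-∸ (suc t) X Y ⟨
        suc t * (X ∸ Y)         ≡⟨ *-comm (suc t) (X ∸ Y) ⟩
        (X ∸ Y) * suc t         ∎) ⟩
      (X ∸ Y) * suc t / suc t   ≡⟨ m*n/n≡m (X ∸ Y) (suc t) ⟩
      X ∸ Y                     ∎

module ProductCoefficients where
  open import Data.Nat
  open import Data.Nat.Properties
  open import Data.Nat.Combinatorics using (_C_; nCk+nC[k+1]≡[n+1]C[k+1]; nCn≡1)
  open import Data.Nat.Tactic.RingSolver using (solve-∀)
  open import Data.Sum using (_⊎_; inj₁; inj₂)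
  import Data.Sum as Sum
  open import Data.Product using (_×_; _,_)
  open import Function using (_∘_)
  open import Relation.Nullary using (¬_; yes; no; contradiction)
  open import Relation.Binary.PropositionalEquality
  open ≡-Reasoning
  open CatalanNumbers using (catalan-split)

  -- κ p q i j is the coefficient of a monomial with i squares and j simple factors in e_p e_q.
  κ : ℕ → ℕ → ℕ → ℕ → ℕ
  κ (suc p) (suc q) (suc i) j       = κ p q i j
  κ _       _       (suc _) _       = 0
  κ zero    zero    zero    zero    = 1
  κ zero    (suc q) zero    (suc j) = κ zero q zero j
  κ (suc p) zero    zero    (suc j) = κ p zero zero j
  κ (suc p) (suc q) zero    (suc j) = κ p (suc q) zero j + κ (suc p) q zero j
  κ _       _       zero    _       = 0

  κ-0-0-sucʲ : ∀ i j → κ 0 0 i (suc j) ≡ 0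
  κ-0-0-sucʲ zero    j = refl
  κ-0-0-sucʲ (suc i) j = refl

  κ-0-sucʲ : ∀ q i j → κ 0 (suc q) i (suc j) ≡ κ 0 q i j
  κ-0-sucʲ q zero    j = refl
  κ-0-sucʲ q (suc i) j = refl

  κ-sucʲ-0 : ∀ p i j → κ (suc p) 0 i (suc j) ≡ κ p 0 i j
  κ-sucʲ-0 p       zero    j = refl
  κ-sucʲ-0 zero    (suc i) j = refl
  κ-sucʲ-0 (suc p) (suc i) j = refl

  κ-sucʲ : ∀ p q i j → κ (suc p) (suc q) i (suc j) ≡ κ p (suc q) i j + κ (suc p) q i j
  κ-sucʲ p       q       zero    j = refl
  κ-sucʲ zero    zero    (suc i) j = κ-0-0-sucʲ i j
  κ-sucʲ zero    (suc q) (suc i) j = κ-0-sucʲ q i j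
  κ-sucʲ (suc p) zero    (suc i) j = trans (κ-sucʲ-0 p i j) (sym (+-identityʳ _))
  κ-sucʲ (suc p) (suc q) (suc i) j = κ-sucʲ p q i j

  κ-shift : ∀ i p q j → κ (i + p) (i + q) i j ≡ κ p q 0 j
  κ-shift zero    p q j = refl
  κ-shift (suc i) p q j = κ-shift i p q j

  κ-beyond : ∀ p q i j → p < i ⊎ q < i → κ p q i j ≡ 0
  κ-beyond p       q       zero    j (inj₁ ())
  κ-beyond p       q       zero    j (inj₂ ())
  κ-beyond zero    q       (suc i) j _ = refl
  κ-beyond (suc p) zero    (suc i) j _ = refl
  κ-beyond (suc p) (suc q) (suc i) j (inj₁ (s≤s p<i)) = κ-beyond p q i j (inj₁ p<i)
  κ-beyond (suc p) (suc q) (suc i) j (inj₂ (s≤s q<i)) = κ-beyond p q i j (inj₂ q<i)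

  private
    κ-off-line₀ : ∀ p q j → j ≢ p + q → κ p q 0 j ≡ 0
    κ-off-line₀ zero    zero    zero    j≢ = contradiction refl j≢
    κ-off-line₀ zero    (suc q) zero    _  = refl
    κ-off-line₀ (suc p) zero    zero    _  = refl
    κ-off-line₀ (suc p) (suc q) zero    _  = refl
    κ-off-line₀ zero    zero    (suc j) _  = refl
    κ-off-line₀ zero    (suc q) (suc j) j≢ = κ-off-line₀ zero q j (j≢ ∘ cong suc)
    κ-off-line₀ (suc p) zero    (suc j) j≢ = κ-off-line₀ p zero j (j≢ ∘ cong suc)
    κ-off-line₀ (suc p) (suc q) (suc j) j≢ = cong₂ _+_
      (κ-off-line₀ p (suc q) j (j≢ ∘ cong suc))
      (κ-off-line₀ (suc p) q j (λ e → j≢ (cong suc (trans e (sym (+-suc p q))))))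

  κ-off-line : ∀ p q i j → j + 2 * i ≢ p + q → κ p q i j ≡ 0
  κ-off-line p       q       zero    j ≢ = κ-off-line₀ p q j (≢ ∘ trans (+-identityʳ j))
  κ-off-line zero    q       (suc i) j _ = refl
  κ-off-line (suc p) zero    (suc i) j _ = refl
  κ-off-line (suc p) (suc q) (suc i) j ≢ = κ-off-line p q i j (≢ ∘ step)
    where
    step : j + 2 * i ≡ p + q → j + 2 * suc i ≡ suc p + suc q
    step e = begin
      j + 2 * suc i       ≡⟨ shift j i ⟩
      2 + (j + 2 * i)     ≡⟨ cong (2 +_) e ⟩
      2 + (p + q)         ≡⟨ cong suc (+-suc p q) ⟨
      suc p + suc q       ∎
      where
      shift : ∀ j i → j + 2 * suc i ≡ 2 + (j + 2 * i)
      shift = solve-∀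

  κ-diagonal : ∀ p q → κ p q 0 (p + q) ≡ (p + q) C p
  κ-diagonal zero    zero    = refl
  κ-diagonal zero    (suc q) = κ-diagonal zero q
  κ-diagonal (suc p) zero    = begin
    κ p 0 0 (p + 0)        ≡⟨ κ-diagonal p 0 ⟩
    (p + 0) C p            ≡⟨ [n+0]Cn≡1 p ⟩
    1                      ≡⟨ [n+0]Cn≡1 (suc p) ⟨
    (suc p + 0) C suc p    ∎
    where
    [n+0]Cn≡1 : ∀ n → (n + 0) C n ≡ 1
    [n+0]Cn≡1 n = trans (cong (_C n) (+-identityʳ n)) (nCn≡1 n)
  κ-diagonal (suc p) (suc q) = begin
    κ p (suc q) 0 (p + suc q) + κ (suc p) q 0 (p + suc q)
      ≡⟨ cong (κ p (suc q) 0 (p + suc q) +_) (cong (κ (suc p) q 0) (+-suc p q)) ⟩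
    κ p (suc q) 0 (p + suc q) + κ (suc p) q 0 (suc p + q)
      ≡⟨ cong₂ _+_ (κ-diagonal p (suc q)) (κ-diagonal (suc p) q) ⟩
    (p + suc q) C p + (suc p + q) C suc p
      ≡⟨ cong (λ n → (p + suc q) C p + n C suc p) (+-suc p q) ⟨
    (p + suc q) C p + (p + suc q) C suc p
      ≡⟨ nCk+nC[k+1]≡[n+1]C[k+1] (p + suc q) p ⟩
    suc (p + suc q) C suc p ∎

  κ-on-line : ∀ {p q i j} p′ q′ → i + p′ ≡ p → i + q′ ≡ q → p′ + q′ ≡ j → κ p q i j ≡ j C p′
  κ-on-line {i = i} p′ q′ refl refl refl = trans (κ-shift i p′ q′ (p′ + q′)) (κ-diagonal p′ q′)

  κ-supported : ∀ {D n p q} → p ≤ D ⊎ q ≤ D → p + q ≡ n →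
                ∀ i j → ¬ (i ≤ D × j + 2 * i ≡ n) → κ p q i j ≡ 0
  κ-supported {D} {n} {p} {q} small p+q≡n i j off with i ≤? D
  ... | yes i≤D = κ-off-line p q i j (λ e → off (i≤D , trans e p+q≡n))
  ... | no  i≰D = κ-beyond p q i j (Sum.map below below small)
    where
    below : ∀ {x} → x ≤ D → x < i
    below x≤D = ≤-<-trans x≤D (≰⇒> i≰D)

  line-coordinates : ∀ {D k c n} → k ≤ D → n ≡ c + 2 * D →
                     (D ∸ k) + k ≡ D × n ∸ 2 * (D ∸ k) ≡ c + 2 * k
  line-coordinates {D} {k} {c} {n} k≤D n≡ = m∸n+n≡m k≤D , (begin
    n ∸ 2 * (D ∸ k)
      ≡⟨ cong (_∸ 2 * (D ∸ k)) (trans n≡ (cong (λ x → c + 2 * x) (sym (m∸n+n≡m k≤D)))) ⟩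
    c + 2 * (D ∸ k + k) ∸ 2 * (D ∸ k)     ≡⟨ cong (_∸ 2 * (D ∸ k)) (regroup c (D ∸ k) k) ⟩
    c + 2 * k + 2 * (D ∸ k) ∸ 2 * (D ∸ k) ≡⟨ m+n∸n≡m (c + 2 * k) (2 * (D ∸ k)) ⟩
    c + 2 * k                             ∎)
    where
    regroup : ∀ c a k → c + 2 * (a + k) ≡ c + 2 * k + 2 * a
    regroup = solve-∀

  n+n≡2*n : ∀ n → n + n ≡ 2 * n
  n+n≡2*n n = cong (n +_) (sym (+-identityʳ n))

  n+[2+n]≡2*[1+n] : ∀ n → n + (2 + n) ≡ 2 * suc n
  n+[2+n]≡2*[1+n] = solve-∀

  2*[1+n]∸1≡1+2*n : ∀ n → 2 * suc n ∸ 1 ≡ 1 + 2 * n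
  2*[1+n]∸1≡1+2*n n = +-suc n (n + 0)

  2*[1+n]∸2≡2*n : ∀ n → 2 * suc n ∸ 2 ≡ 2 * n
  2*[1+n]∸2≡2*n n = cong (_∸ 1) (+-suc n (n + 0))

  κ-square : ∀ {E i j} k → i + k ≡ E → j ≡ 2 * k → κ E E i j ≡ (2 * k) C k
  κ-square k i+k≡E refl = κ-on-line k k i+k≡E i+k≡E (n+n≡2*n k)

  κ-consecutive : ∀ {E i j} k → i + k ≡ E → j ≡ 1 + 2 * k → κ (suc E) E i j ≡ (2 * suc k ∸ 1) C suc k
  κ-consecutive {E} {i} k i+k≡E refl = begin
    κ (suc E) E i (1 + 2 * k)
      ≡⟨ κ-on-line (suc k) k (trans (+-suc i k) (cong suc i+k≡E)) i+k≡E (cong suc (n+n≡2*n k)) ⟩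
    (1 + 2 * k) C suc k       ≡⟨ cong (_C suc k) (sym (+-suc k (k + 0))) ⟩
    (2 * suc k ∸ 1) C suc k   ∎

  κ-catalan : ∀ {E i j} k → i + k ≡ suc E → j ≡ 2 * k →
              κ (suc E) (suc E) i j ≡ catalan k + κ E (2 + E) i j
  κ-catalan {E} {i} zero i+0≡1+E refl = begin
    κ (suc E) (suc E) i 0       ≡⟨ κ-on-line 0 0 i+0≡1+E i+0≡1+E refl ⟩
    1                           ≡⟨ cong (1 +_) (κ-beyond E (2 + E) i 0 (inj₁ E<i)) ⟨
    catalan 0 + κ E (2 + E) i 0 ∎
    where
    E<i : E < i
    E<i = ≤-reflexive (sym (trans (sym (+-identityʳ i)) i+0≡1+E))
  κ-catalan {E} {i} (suc s) i+k≡1+E refl = begin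
    κ (suc E) (suc E) i (2 * suc s)
      ≡⟨ κ-on-line (suc s) (suc s) i+k≡1+E i+k≡1+E (n+n≡2*n (suc s)) ⟩
    (2 * suc s) C suc s
      ≡⟨ catalan-split s ⟩
    catalan (suc s) + (2 * suc s) C s
      ≡⟨ cong (catalan (suc s) +_) (κ-on-line s (2 + s) i+s≡E i+2+s≡2+E (n+[2+n]≡2*[1+n] s)) ⟨
    catalan (suc s) + κ E (2 + E) i (2 * suc s) ∎
    where
    i+s≡E : i + s ≡ E
    i+s≡E = suc-injective (trans (sym (+-suc i s)) i+k≡1+E)
    i+2+s≡2+E : i + (2 + s) ≡ 2 + E
    i+2+s≡2+E = trans (+-suc i (suc s)) (cong suc i+k≡1+E)

module ShapeIndicator where
  open import Data.Nat
  open import Data.Nat.Properties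
  open import Data.Bool using (_∧_; false)
  open import Data.Product using (_×_; _,_)
  open import Function.Bundles using (mk⇔)
  open import Relation.Nullary using (¬_; _×-dec_)
  open import Relation.Nullary.Decidable using (does-⇔; dec-false)
  open import Relation.Binary.PropositionalEquality

  shape-select : ∀ {D i j k n} → i ≤ D → k ≤ D → j + 2 * i ≡ n →
                 ((i ≡ᵇ D ∸ k) ∧ (j + 2 * (D ∸ k) ≡ᵇ n)) ≡ (k ≡ᵇ D ∸ i)
  shape-select {D} {i} {j} {k} {n} i≤D k≤D on-line =
    does-⇔ (mk⇔ to from) ((i ≟ D ∸ k) ×-dec (j + 2 * (D ∸ k) ≟ n)) (k ≟ D ∸ i)
    where
    to : i ≡ D ∸ k × j + 2 * (D ∸ k) ≡ n → k ≡ D ∸ i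
    to (i≡D∸k , _) = trans (sym (m∸[m∸n]≡n k≤D)) (cong (D ∸_) (sym i≡D∸k))
    from : k ≡ D ∸ i → i ≡ D ∸ k × j + 2 * (D ∸ k) ≡ n
    from k≡D∸i = i≡D∸k , trans (cong (λ x → j + 2 * x) (sym i≡D∸k)) on-line
      where
      i≡D∸k = trans (sym (m∸[m∸n]≡n i≤D)) (cong (D ∸_) (sym k≡D∸i))

  shape-off : ∀ {D i j k n} → ¬ (i ≤ D × j + 2 * i ≡ n) →
              ((i ≡ᵇ D ∸ k) ∧ (j + 2 * (D ∸ k) ≡ᵇ n)) ≡ false
  shape-off {D} {i} {j} {k} {n} off = dec-false ((i ≟ D ∸ k) ×-dec (j + 2 * (D ∸ k) ≟ n))
    λ (i≡D∸k , on-line) → off ( subst (_≤ D) (sym i≡D∸k) (m∸n≤m D k)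
                              , subst (λ x → j + 2 * x ≡ n) (sym i≡D∸k) on-line)

module SymmetricFunctions {c ℓ : Level} (R : CommutativeRing c ℓ) where
  open CommutativeRing R hiding (zero)
  open Poly R
  open import Data.Nat using (zero; _≡ᵇ_; z≤n)
  import Data.Nat.Properties as ℕₚ
  open import Data.Bool using (Bool; true; false; if_then_else_; _∧_)
  open import Data.Vec.Functional using (head; tail)
  open import Data.List using (List; []; _∷_; _++_; map; concatMap; applyUpTo)
  open import Data.Vec using (_∷_)
  open import Data.List.Properties using (map-concatMap; map-applyUpTo)
  open import Data.List.Relation.Unary.All as All using (All; []; _∷_)
  open import Data.List.Relation.Unary.All.Properties using (applyUpTo⁺₁)
  open import Data.Product using (_×_; _,_)
  open import Data.Sum using (_⊎_; inj₁; inj₂)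
  open import Function using (id; _∘_)
  open import Relation.Nullary using (¬_; yes; no; _×-dec_)
  open import Relation.Binary.PropositionalEquality as ≡ using (_≡_)
  open import Relation.Binary.Reasoning.Setoid setoid
  open import Algebra.Solver.Ring.NaturalCoefficients.Default commutativeSemiring
  open ProductCoefficients
  open ShapeIndicator

  fromBool : Bool → Carrier
  fromBool true  = 1#
  fromBool false = 0#

  δ : ℕ → ℕ → Carrier
  δ k c = fromBool (c ≡ᵇ k)

  if-as-fromBool : ∀ b x → (if b then x else 0#) ≈ fromBool b * x
  if-as-fromBool true  x = sym (*-identityˡ x)
  if-as-fromBool false x = sym (zeroˡ x)

  ι-+ : ∀ m n → ι (m N.+ n) ≈ ι m + ι n
  ι-+ zero    n = sym (+-identityˡ (ι n))
  ι-+ (suc m) n = trans (+-congˡ (ι-+ m n)) (sym (+-assoc 1# (ι m) (ι n)))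

  sumL-++ : ∀ xs ys → sumL (xs ++ ys) ≈ sumL xs + sumL ys
  sumL-++ []       ys = sym (+-identityˡ (sumL ys))
  sumL-++ (x ∷ xs) ys = trans (+-congˡ (sumL-++ xs ys)) (sym (+-assoc x (sumL xs) (sumL ys)))

  sumL-concatMap : ∀ {A : Set} (g : A → List Carrier) xs →
                   sumL (concatMap g xs) ≈ sumL (map (sumL ∘ g) xs)
  sumL-concatMap g []       = refl
  sumL-concatMap g (x ∷ xs) = trans (sumL-++ (g x) (concatMap g xs)) (+-congˡ (sumL-concatMap g xs))

  sumL-map-congᴬ : ∀ {A : Set} {f g : A → Carrier} {xs} →
                   All (λ x → f x ≈ g x) xs → sumL (map f xs) ≈ sumL (map g xs)
  sumL-map-congᴬ []         = refl
  sumL-map-congᴬ (fx≈gx ∷ eqs) = +-cong fx≈gx (sumL-map-congᴬ eqs)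

  sumL-map-cong : ∀ {A : Set} {f g : A → Carrier} xs →
                  (∀ x → f x ≈ g x) → sumL (map f xs) ≈ sumL (map g xs)
  sumL-map-cong xs f≈g = sumL-map-congᴬ (All.universal f≈g xs)

  sumL-map-+ : ∀ {A : Set} (f g : A → Carrier) xs →
               sumL (map (λ x → f x + g x) xs) ≈ sumL (map f xs) + sumL (map g xs)
  sumL-map-+ f g []       = sym (+-identityˡ 0#)
  sumL-map-+ f g (x ∷ xs) = trans (+-congˡ (sumL-map-+ f g xs)) (+-interchange′ (f x) (g x) _ _)
    where
    +-interchange′ : ∀ a b u v → (a + b) + (u + v) ≈ (a + u) + (b + v)
    +-interchange′ = solve 4 (λ a b u v → (a :+ b) :+ (u :+ v) := (a :+ u) :+ (b :+ v)) refl

  sumL-map-*ˡ : ∀ {A : Set} a (f : A → Carrier) xs →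
                sumL (map (λ x → a * f x) xs) ≈ a * sumL (map f xs)
  sumL-map-*ˡ a f []       = sym (zeroʳ a)
  sumL-map-*ˡ a f (x ∷ xs) = trans (+-congˡ (sumL-map-*ˡ a f xs)) (sym (distribˡ a (f x) _))

  sumL-map-0# : ∀ {A : Set} (xs : List A) → sumL (map (λ _ → 0#) xs) ≈ 0#
  sumL-map-0# []       = refl
  sumL-map-0# (x ∷ xs) = trans (+-identityˡ _) (sumL-map-0# xs)

  sumTo-suc : ∀ D f → sumTo (suc D) f ≈ f 0 + sumTo D (f ∘ suc)
  sumTo-suc D f = reflexive (≡.cong (λ xs → f 0 + sumL xs)
    (≡.trans (map-applyUpTo suc f (suc D)) (≡.sym (map-applyUpTo id (f ∘ suc) (suc D)))))

  sumTo-cong : ∀ D {f g} → (∀ k → k ≤ D → f k ≈ g k) → sumTo D f ≈ sumTo D g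
  sumTo-cong D f≈g = sumL-map-congᴬ (applyUpTo⁺₁ id (suc D) (λ k<1+D → f≈g _ (ℕₚ.≤-pred k<1+D)))

  sumTo-0# : ∀ D → sumTo D (λ _ → 0#) ≈ 0#
  sumTo-0# D = sumL-map-0# (applyUpTo id (suc D))

  sumTo-select : ∀ D (g : ℕ → Carrier) {t} → t ≤ D → sumTo D (λ k → g k * δ t k) ≈ g t
  sumTo-select zero    g z≤n = trans (+-identityʳ _) (*-identityʳ (g 0))
  sumTo-select (suc D) g z≤n = begin
    sumTo (suc D) (λ k → g k * fromBool (k ≡ᵇ 0)) ≈⟨ sumTo-suc D _ ⟩
    g 0 * 1# + sumTo D (λ k → g (suc k) * 0#)
      ≈⟨ +-cong (*-identityʳ (g 0)) (trans (sumTo-cong D (λ k _ → zeroʳ (g (suc k)))) (sumTo-0# D)) ⟩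
    g 0 + 0#                                     ≈⟨ +-identityʳ (g 0) ⟩
    g 0                                          ∎
  sumTo-select (suc D) g {suc t} (s≤s t≤D) = begin
    sumTo (suc D) (λ k → g k * fromBool (k ≡ᵇ suc t))       ≈⟨ sumTo-suc D _ ⟩
    g 0 * 0# + sumTo D (λ k → g (suc k) * fromBool (k ≡ᵇ t)) ≈⟨ +-cong (zeroʳ (g 0)) (sumTo-select D (g ∘ suc) t≤D) ⟩
    0# + g (suc t)                                           ≈⟨ +-identityˡ (g (suc t)) ⟩
    g (suc t)                                                ∎

  esym : ℕ → ∀ {n} → (Fin n → Carrier) → Carrier
  esym zero    y = 1#
  esym (suc k) {zero}  y = 0#
  esym (suc k) {suc n} y = esym (suc k) (tail y) + head y * esym k (tail y)

  subsetSum : ∀ {n} → (Fin n → Carrier) → (ℕ → Carrier) → Carrier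
  subsetSum {n} y g = sumL (map (λ S → g (card S) * prodSub y S) (allSubsets n))

  subsetSum-cong : ∀ {n} (y : Fin n → Carrier) {g g′} → (∀ k → g k ≈ g′ k) → subsetSum y g ≈ subsetSum y g′
  subsetSum-cong {n} y g≈g′ = sumL-map-cong (allSubsets n) (λ S → *-congʳ (g≈g′ (card S)))

  subsetSum-+ : ∀ {n} (y : Fin n → Carrier) g g′ → subsetSum y (λ k → g k + g′ k) ≈ subsetSum y g + subsetSum y g′
  subsetSum-+ {n} y g g′ = trans (sumL-map-cong (allSubsets n) (λ S → distribʳ _ _ _)) (sumL-map-+ _ _ (allSubsets n))

  subsetSum-*ˡ : ∀ {n} (y : Fin n → Carrier) a g → subsetSum y (λ k → a * g k) ≈ a * subsetSum y g
  subsetSum-*ˡ {n} y a g = trans (sumL-map-cong (allSubsets n) (λ S → *-assoc _ _ _)) (sumL-map-*ˡ a _ (allSubsets n))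

  subsetSum-0# : ∀ {n} (y : Fin n → Carrier) → subsetSum y (λ _ → 0#) ≈ 0#
  subsetSum-0# {n} y = trans (sumL-map-cong (allSubsets n) (λ S → zeroˡ _)) (sumL-map-0# (allSubsets n))

  subsetSum-suc : ∀ {n} (y : Fin (suc n) → Carrier) g →
                  subsetSum y g ≈ subsetSum (tail y) g + head y * subsetSum (tail y) (g ∘ suc)
  subsetSum-suc {n} y g = begin
    sumL (map F (concatMap (λ S → (false ∷ S) ∷ (true ∷ S) ∷ []) (allSubsets n)))
      ≡⟨ ≡.cong sumL (map-concatMap F _ (allSubsets n)) ⟩
    sumL (concatMap (λ S → F (false ∷ S) ∷ F (true ∷ S) ∷ []) (allSubsets n))
      ≈⟨ sumL-concatMap _ (allSubsets n) ⟩
    sumL (map (λ S → F (false ∷ S) + (F (true ∷ S) + 0#)) (allSubsets n))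
      ≈⟨ sumL-map-cong (allSubsets n) (λ S → regroup _ (g (suc (card S))) (head y) _) ⟩
    sumL (map (λ S → F (false ∷ S) + head y * (g (suc (card S)) * prodSub (tail y) S)) (allSubsets n))
      ≈⟨ trans (sumL-map-+ _ _ (allSubsets n)) (+-congˡ (sumL-map-*ˡ (head y) _ (allSubsets n))) ⟩
    subsetSum (tail y) g + head y * subsetSum (tail y) (g ∘ suc) ∎
    where
    F = λ S → g (card S) * prodSub y S
    regroup : ∀ a b x p → a + (b * (x * p) + 0#) ≈ a + x * (b * p)
    regroup = solve 4 (λ a b x p → a :+ (b :* (x :* p) :+ con 0) := a :+ x :* (b :* p)) refl

  esym-as-subsetSum : ∀ {n} k (y : Fin n → Carrier) → subsetSum y (δ k) ≈ esym k y
  esym-as-subsetSum {zero}  zero    y = trans (+-identityʳ _) (*-identityʳ 1#)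
  esym-as-subsetSum {zero}  (suc k) y = trans (+-identityʳ _) (zeroˡ 1#)
  esym-as-subsetSum {suc n} zero    y = begin
    subsetSum y (δ 0)                                        ≈⟨ subsetSum-suc y (δ 0) ⟩
    subsetSum (tail y) (δ 0) + head y * subsetSum (tail y) (λ _ → 0#)
      ≈⟨ +-cong (esym-as-subsetSum 0 (tail y)) (trans (*-congˡ (subsetSum-0# (tail y))) (zeroʳ (head y))) ⟩
    1# + 0#                                                 ≈⟨ +-identityʳ 1# ⟩
    1#                                                      ∎
  esym-as-subsetSum {suc n} (suc k) y = trans (subsetSum-suc y (δ (suc k)))
    (+-cong (esym-as-subsetSum (suc k) (tail y)) (*-congˡ (esym-as-subsetSum k (tail y))))

  subsetSum-≤2 : ∀ {n} (y : Fin n → Carrier) G {u₀ u₁ u₂} →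
                 G 0 ≈ u₀ → G 1 ≈ u₁ → G 2 ≈ u₂ → (∀ c → G (3 N.+ c) ≈ 0#) →
                 subsetSum y G ≈ u₀ + u₁ * esym 1 y + u₂ * esym 2 y
  subsetSum-≤2 y G {u₀} {u₁} {u₂} G0 G1 G2 G3+ = begin
    subsetSum y G                                            ≈⟨ subsetSum-cong y G≈ ⟩
    subsetSum y (λ c → U₀ c + U₁ c + U₂ c)
      ≈⟨ trans (subsetSum-+ y (λ c → U₀ c + U₁ c) U₂) (+-congʳ (subsetSum-+ y U₀ U₁)) ⟩
    subsetSum y U₀ + subsetSum y U₁ + subsetSum y U₂
      ≈⟨ +-cong (+-cong (coefficient u₀ 0) (coefficient u₁ 1)) (coefficient u₂ 2) ⟩
    u₀ * 1# + u₁ * esym 1 y + u₂ * esym 2 y                 ≈⟨ +-congʳ (+-congʳ (*-identityʳ u₀)) ⟩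
    u₀ + u₁ * esym 1 y + u₂ * esym 2 y                      ∎
    where
    U₀ U₁ U₂ : ℕ → Carrier
    U₀ c = u₀ * δ 0 c
    U₁ c = u₁ * δ 1 c
    U₂ c = u₂ * δ 2 c
    coefficient : ∀ u k → subsetSum y (λ c → u * δ k c) ≈ u * esym k y
    coefficient u k = trans (subsetSum-*ˡ y u (δ k)) (*-congˡ (esym-as-subsetSum k y))
    G≈ : ∀ c → G c ≈ U₀ c + U₁ c + U₂ c
    G≈ 0 = trans G0 (solve 3 (λ a b c → a := a :* con 1 :+ b :* con 0 :+ c :* con 0) refl u₀ u₁ u₂)
    G≈ 1 = trans G1 (solve 3 (λ a b c → b := a :* con 0 :+ b :* con 1 :+ c :* con 0) refl u₀ u₁ u₂)
    G≈ 2 = trans G2 (solve 3 (λ a b c → c := a :* con 0 :+ b :* con 0 :+ c :* con 1) refl u₀ u₁ u₂)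
    G≈ (suc (suc (suc c))) = trans (G3+ c) (solve 3 (λ a b c → con 0 := a :* con 0 :+ b :* con 0 :+ c :* con 0) refl u₀ u₁ u₂)

  -- Every product e_p e_q and every m_{[n,i]} is of this form.
  expSum : ∀ {n} → (Fin n → Carrier) → (ℕ → ℕ → Carrier) → Carrier
  expSum {n} y h = sumL (map (λ α → h (count 2 α) (count 1 α) * monom y α) (allExps n))

  expSum-cong : ∀ {n} (y : Fin n → Carrier) {h h′} → (∀ i j → h i j ≈ h′ i j) → expSum y h ≈ expSum y h′
  expSum-cong {n} y h≈h′ = sumL-map-cong (allExps n) (λ α → *-congʳ (h≈h′ (count 2 α) (count 1 α)))

  expSum-+ : ∀ {n} (y : Fin n → Carrier) h h′ → expSum y (λ i j → h i j + h′ i j) ≈ expSum y h + expSum y h′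
  expSum-+ {n} y h h′ = trans (sumL-map-cong (allExps n) (λ α → distribʳ _ _ _)) (sumL-map-+ _ _ (allExps n))

  expSum-*ˡ : ∀ {n} (y : Fin n → Carrier) a h → expSum y (λ i j → a * h i j) ≈ a * expSum y h
  expSum-*ˡ {n} y a h = trans (sumL-map-cong (allExps n) (λ α → *-assoc _ _ _)) (sumL-map-*ˡ a _ (allExps n))

  expSum-0# : ∀ {n} (y : Fin n → Carrier) → expSum y (λ _ _ → 0#) ≈ 0#
  expSum-0# {n} y = trans (sumL-map-cong (allExps n) (λ α → zeroˡ _)) (sumL-map-0# (allExps n))

  expSum-sumL : ∀ {n} (y : Fin n → Carrier) {A : Set} (H : A → ℕ → ℕ → Carrier) xs →
                sumL (map (λ x → expSum y (H x)) xs) ≈ expSum y (λ i j → sumL (map (λ x → H x i j) xs))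
  expSum-sumL y H []       = sym (expSum-0# y)
  expSum-sumL y H (x ∷ xs) = trans (+-congˡ (expSum-sumL y H xs)) (sym (expSum-+ y (H x) (λ i j → sumL (map (λ x → H x i j) xs))))

  expSum-[] : (y : Fin 0 → Carrier) (h : ℕ → ℕ → Carrier) → expSum y h ≈ h 0 0
  expSum-[] y h = trans (+-identityʳ _) (*-identityʳ (h 0 0))

  expSum-suc : ∀ {n} (y : Fin (suc n) → Carrier) h {a b c} →
               expSum (tail y) h ≈ a →
               expSum (tail y) (λ i j → h i (suc j)) ≈ b →
               expSum (tail y) (λ i j → h (suc i) j) ≈ c →
               expSum y h ≈ a + (head y * b + (head y * head y) * c)
  expSum-suc {n} y h {a} {b} {c} ha hb hc = begin
    sumL (map F (concatMap (λ α → (0 ∷ α) ∷ (1 ∷ α) ∷ (2 ∷ α) ∷ []) (allExps n)))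
      ≡⟨ ≡.cong sumL (map-concatMap F _ (allExps n)) ⟩
    sumL (concatMap (λ α → F (0 ∷ α) ∷ F (1 ∷ α) ∷ F (2 ∷ α) ∷ []) (allExps n))
      ≈⟨ sumL-concatMap _ (allExps n) ⟩
    sumL (map (λ α → F (0 ∷ α) + (F (1 ∷ α) + (F (2 ∷ α) + 0#))) (allExps n))
      ≈⟨ sumL-map-cong (allExps n) (λ α → regroup _ _ _ (head y) _) ⟩
    sumL (map (λ α → G α + (head y * G¹ α + (head y * head y) * G² α)) (allExps n))
      ≈⟨ trans (sumL-map-+ _ _ (allExps n)) (+-congˡ (trans (sumL-map-+ _ _ (allExps n))
           (+-cong (sumL-map-*ˡ (head y) G¹ (allExps n)) (sumL-map-*ˡ (head y * head y) G² (allExps n))))) ⟩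
    expSum (tail y) h + (head y * expSum (tail y) (λ i j → h i (suc j)) + (head y * head y) * expSum (tail y) (λ i j → h (suc i) j))
      ≈⟨ +-cong ha (+-cong (*-congˡ hb) (*-congˡ hc)) ⟩
    a + (head y * b + (head y * head y) * c) ∎
    where
    F = λ α → h (count 2 α) (count 1 α) * monom y α
    G = λ α → h (count 2 α) (count 1 α) * monom (tail y) α
    G¹ = λ α → h (count 2 α) (suc (count 1 α)) * monom (tail y) α
    G² = λ α → h (suc (count 2 α)) (count 1 α) * monom (tail y) α
    regroup : ∀ a b c x m →
      a * (1# * m) + (b * ((x * 1#) * m) + (c * ((x * (x * 1#)) * m) + 0#)) ≈ a * m + (x * (b * m) + (x * x) * (c * m))
    regroup = solve 5 (λ a b c x m →
      a :* (con 1 :* m) :+ (b :* ((x :* con 1) :* m) :+ (c :* ((x :* (x :* con 1)) :* m) :+ con 0))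
      := a :* m :+ (x :* (b :* m) :+ (x :* x) :* (c :* m))) refl

  κ̂ : ℕ → ℕ → ℕ → ℕ → Carrier
  κ̂ p q i j = ι (κ p q i j)

  esym-product : ∀ {n} p q (y : Fin n → Carrier) → esym p y * esym q y ≈ expSum y (κ̂ p q)
  esym-product {zero}  zero    zero    y = trans (*-identityʳ 1#) (sym (trans (expSum-[] y (κ̂ 0 0)) (+-identityʳ 1#)))
  esym-product {zero}  zero    (suc q) y = trans (zeroʳ 1#) (sym (expSum-[] y (κ̂ 0 (suc q))))
  esym-product {zero}  (suc p) zero    y = trans (zeroˡ 1#) (sym (expSum-[] y (κ̂ (suc p) 0)))
  esym-product {zero}  (suc p) (suc q) y = trans (zeroˡ 0#) (sym (expSum-[] y (κ̂ (suc p) (suc q))))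
  esym-product {suc n} zero    zero    y = sym (trans
    (expSum-suc y (κ̂ 0 0) (sym (esym-product 0 0 (tail y)))
      (trans (expSum-cong (tail y) (λ i j → reflexive (≡.cong ι (κ-0-0-sucʲ i j)))) (expSum-0# (tail y)))
      (expSum-0# (tail y)))
    (solve 1 (λ x → con 1 :* con 1 :+ (x :* con 0 :+ (x :* x) :* con 0) := con 1 :* con 1) refl (head y)))
  esym-product {suc n} zero    (suc q) y = sym (trans
    (expSum-suc y (κ̂ 0 (suc q)) (sym (esym-product 0 (suc q) (tail y)))
      (trans (expSum-cong (tail y) (λ i j → reflexive (≡.cong ι (κ-0-sucʲ q i j)))) (sym (esym-product 0 q (tail y))))
      (expSum-0# (tail y)))
    (solve 3 (λ a b x → con 1 :* a :+ (x :* (con 1 :* b) :+ (x :* x) :* con 0) := con 1 :* (a :+ x :* b)) refl _ _ (head y)))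
  esym-product {suc n} (suc p) zero    y = sym (trans
    (expSum-suc y (κ̂ (suc p) 0) (sym (esym-product (suc p) 0 (tail y)))
      (trans (expSum-cong (tail y) (λ i j → reflexive (≡.cong ι (κ-sucʲ-0 p i j)))) (sym (esym-product p 0 (tail y))))
      (expSum-0# (tail y)))
    (solve 3 (λ a b x → a :* con 1 :+ (x :* (b :* con 1) :+ (x :* x) :* con 0) := (a :+ x :* b) :* con 1) refl _ _ (head y)))
  esym-product {suc n} (suc p) (suc q) y = sym (trans
    (expSum-suc y (κ̂ (suc p) (suc q)) (sym (esym-product (suc p) (suc q) (tail y)))
      (trans (expSum-cong (tail y) λ i j →
                trans (reflexive (≡.cong ι (κ-sucʲ p q i j))) (ι-+ (κ p (suc q) i j) (κ (suc p) q i j)))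
        (trans (expSum-+ (tail y) (κ̂ p (suc q)) (κ̂ (suc p) q))
               (+-cong (sym (esym-product p (suc q) (tail y))) (sym (esym-product (suc p) q (tail y))))))
      (sym (esym-product p q (tail y))))
    (solve 5 (λ a b c d x → a :* c :+ (x :* (b :* c :+ a :* d) :+ (x :* x) :* (b :* d)) := (a :+ x :* b) :* (c :+ x :* d))
           refl _ _ _ _ (head y)))

  shape : ℕ → ℕ → ℕ → ℕ → Carrier
  shape n i₀ i j = fromBool ((i ≡ᵇ i₀) ∧ ((j N.+ 2 N.* i₀) ≡ᵇ n))

  mSym-as-expSum : ∀ {m} (y : Fin m → Carrier) n i₀ → mSym y n i₀ ≈ expSum y (shape n i₀)
  mSym-as-expSum {m} y n i₀ = sumL-map-cong (allExps m) (λ α → if-as-fromBool _ (monom y α))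

  expSum-line : ∀ {m} (y : Fin m → Carrier) D n (h : ℕ → ℕ → Carrier) →
                (∀ i j → ¬ (i ≤ D × j N.+ 2 N.* i ≡ n) → h i j ≈ 0#) →
                expSum y h ≈ sumTo D (λ k → h (D ∸ k) (n ∸ 2 N.* (D ∸ k)) * mSym y n (D ∸ k))
  expSum-line y D n h off-line = sym (begin
    sumTo D (λ k → g k * mSym y n (D ∸ k))
      ≈⟨ sumTo-cong D (λ k _ → trans (*-congˡ (mSym-as-expSum y n (D ∸ k))) (sym (expSum-*ˡ y (g k) (shape n (D ∸ k))))) ⟩
    sumTo D (λ k → expSum y (λ i j → g k * shape n (D ∸ k) i j))
      ≈⟨ expSum-sumL y (λ k i j → g k * shape n (D ∸ k) i j) (applyUpTo id (suc D)) ⟩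
    expSum y (λ i j → sumTo D (λ k → g k * shape n (D ∸ k) i j))
      ≈⟨ expSum-cong y select ⟩
    expSum y h ∎)
    where
    g : ℕ → Carrier
    g k = h (D ∸ k) (n ∸ 2 N.* (D ∸ k))
    select : ∀ i j → sumTo D (λ k → g k * shape n (D ∸ k) i j) ≈ h i j
    select i j with i N.≤? D ×-dec j N.+ 2 N.* i N.≟ n
    ... | yes (i≤D , on-line) = begin
      sumTo D (λ k → g k * shape n (D ∸ k) i j)
        ≈⟨ sumTo-cong D (λ k k≤D → *-congˡ (reflexive (≡.cong fromBool (shape-select {j = j} {k} i≤D k≤D on-line)))) ⟩
      sumTo D (λ k → g k * δ (D ∸ i) k)    ≈⟨ sumTo-select D g (ℕₚ.m∸n≤m D i) ⟩
      g (D ∸ i)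
        ≡⟨ ≡.cong₂ h (ℕₚ.m∸[m∸n]≡n i≤D) (≡.cong (λ x → n ∸ 2 N.* x) (ℕₚ.m∸[m∸n]≡n i≤D)) ⟩
      h i (n ∸ 2 N.* i)
        ≡⟨ ≡.cong (h i) (≡.trans (≡.cong (_∸ 2 N.* i) (≡.sym on-line)) (ℕₚ.m+n∸n≡m j (2 N.* i))) ⟩
      h i j                                ∎
    ... | no off = begin
      sumTo D (λ k → g k * shape n (D ∸ k) i j)
        ≈⟨ sumTo-cong D (λ k _ → trans (*-congˡ (reflexive (≡.cong fromBool (shape-off {j = j} {k} off)))) (zeroʳ (g k))) ⟩
      sumTo D (λ _ → 0#)                   ≈⟨ sumTo-0# D ⟩
      0#                                   ≈⟨ off-line i j off ⟨
      h i j                                ∎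

  esym-product-line : ∀ {m} (y : Fin m → Carrier) D n p q → p ≤ D ⊎ q ≤ D → p N.+ q ≡ n →
    esym p y * esym q y ≈ sumTo D (λ k → κ̂ p q (D ∸ k) (n ∸ 2 N.* (D ∸ k)) * mSym y n (D ∸ k))
  esym-product-line y D n p q small p+q≡n = trans (esym-product p q y)
    (expSum-line y D n (κ̂ p q) (λ i j off → reflexive (≡.cong ι (κ-supported small p+q≡n i j off))))

  esym-square-catalan : ∀ {m} (y : Fin m → Carrier) E →
    esym (suc E) y * esym (suc E) y ≈
      sumTo (suc E) (λ k → ι (catalan k) * mSym y (2 N.* suc E) (suc E ∸ k)) + esym E y * esym (2 N.+ E) y
  esym-square-catalan y E = begin
    esym d y * esym d y
      ≈⟨ esym-product-line y d n d d (inj₁ ℕₚ.≤-refl) (n+n≡2*n d) ⟩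
    sumTo d (λ k → κ̂ d d (d ∸ k) (j k) * mSym y n (d ∸ k))
      ≈⟨ sumTo-cong d split ⟩
    sumTo d (λ k → ι (catalan k) * mSym y n (d ∸ k) + κ̂ E (2 N.+ E) (d ∸ k) (j k) * mSym y n (d ∸ k))
      ≈⟨ sumL-map-+ _ _ (applyUpTo id (suc d)) ⟩
    sumTo d (λ k → ι (catalan k) * mSym y n (d ∸ k)) + sumTo d (λ k → κ̂ E (2 N.+ E) (d ∸ k) (j k) * mSym y n (d ∸ k))
      ≈⟨ +-congˡ (esym-product-line y d n E (2 N.+ E) (inj₁ (ℕₚ.n≤1+n E)) (n+[2+n]≡2*[1+n] E)) ⟨
    sumTo d (λ k → ι (catalan k) * mSym y n (d ∸ k)) + esym E y * esym (2 N.+ E) y ∎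
    where
    d = suc E
    n = 2 N.* d
    j : ℕ → ℕ
    j k = n ∸ 2 N.* (d ∸ k)
    split : ∀ k → k ≤ d → κ̂ d d (d ∸ k) (j k) * mSym y n (d ∸ k) ≈
                            ι (catalan k) * mSym y n (d ∸ k) + κ̂ E (2 N.+ E) (d ∸ k) (j k) * mSym y n (d ∸ k)
    split k k≤d with line-coordinates {c = 0} k≤d ≡.refl
    ... | i+k≡d , j≡2k = trans (*-congʳ (trans (reflexive (≡.cong ι (κ-catalan k i+k≡d j≡2k)))
                                                (ι-+ (catalan k) (κ E (2 N.+ E) (d ∸ k) (j k)))))
                               (distribʳ _ _ _)

  esym-consecutive : ∀ {m} (y : Fin m → Carrier) E →
    esym (suc E) y * esym E y ≈
      sumFrom1To (suc E) (λ k → ι ((2 N.* k ∸ 1) C k) * mSym y (2 N.* suc E ∸ 1) (suc E ∸ k))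
  esym-consecutive y E = trans (esym-product-line y E n (suc E) E (inj₂ ℕₚ.≤-refl) 1+E+E≡n) (sumTo-cong E coefficient)
    where
    n = 2 N.* suc E ∸ 1
    1+E+E≡n : suc E N.+ E ≡ n
    1+E+E≡n = ≡.trans (≡.cong suc (n+n≡2*n E)) (≡.sym (2*[1+n]∸1≡1+2*n E))
    coefficient : ∀ k → k ≤ E → κ̂ (suc E) E (E ∸ k) (n ∸ 2 N.* (E ∸ k)) * mSym y n (E ∸ k) ≈
                                  ι ((2 N.* suc k ∸ 1) C suc k) * mSym y n (E ∸ k)
    coefficient k k≤E with line-coordinates {c = 1} k≤E (2*[1+n]∸1≡1+2*n E)
    ... | i+k≡E , j≡1+2k = *-congʳ (reflexive (≡.cong ι (κ-consecutive k i+k≡E j≡1+2k)))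

  esym-square : ∀ {m} (y : Fin m → Carrier) E →
    esym E y * esym E y ≈ sumTo E (λ k → ι ((2 N.* k) C k) * mSym y (2 N.* suc E ∸ 2) (E ∸ k))
  esym-square y E = trans (esym-product-line y E n E E (inj₁ ℕₚ.≤-refl) E+E≡n) (sumTo-cong E coefficient)
    where
    n = 2 N.* suc E ∸ 2
    E+E≡n : E N.+ E ≡ n
    E+E≡n = ≡.trans (n+n≡2*n E) (≡.sym (2*[1+n]∸2≡2*n E))
    coefficient : ∀ k → k ≤ E → κ̂ E E (E ∸ k) (n ∸ 2 N.* (E ∸ k)) * mSym y n (E ∸ k) ≈
                                  ι ((2 N.* k) C k) * mSym y n (E ∸ k)
    coefficient k k≤E with line-coordinates {c = 0} k≤E (2*[1+n]∸2≡2*n E)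
    ... | i+k≡E , j≡2k = *-congʳ (reflexive (≡.cong ι (κ-square k i+k≡E j≡2k)))

  subsets-of-size≈esym : ∀ {m} k (y : Fin m → Carrier) →
    sumL (map (λ S → if card S ≡ᵇ k then prodSub y S else 0#) (allSubsets m)) ≈ esym k y
  subsets-of-size≈esym {m} k y =
    trans (sumL-map-cong (allSubsets m) (λ S → if-as-fromBool _ (prodSub y S))) (esym-as-subsetSum k y)

  esym₁-square : ∀ {m} (y : Fin m → Carrier) → esym 1 y * esym 1 y ≈ esym 1 (λ p → y p * y p) + (esym 2 y + esym 2 y)
  esym₁-square {zero}  y = solve 0 (con 0 :* con 0 := con 0 :+ (con 0 :+ con 0)) refl
  esym₁-square {suc m} y = begin
    (e₁ + x * 1#) * (e₁ + x * 1#)                            ≈⟨ expand e₁ x ⟩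
    e₁ * e₁ + ((x * x) * 1# + (x * e₁ + x * e₁))             ≈⟨ +-congʳ (esym₁-square (tail y)) ⟩
    (p₂ + (e₂ + e₂)) + ((x * x) * 1# + (x * e₁ + x * e₁))   ≈⟨ regroup p₂ e₂ e₁ x ⟩
    (p₂ + (x * x) * 1#) + ((e₂ + x * e₁) + (e₂ + x * e₁))   ∎
    where
    x = head y
    e₁ = esym 1 (tail y)
    e₂ = esym 2 (tail y)
    p₂ = esym 1 (λ p → tail y p * tail y p)
    expand : ∀ a x → (a + x * 1#) * (a + x * 1#) ≈ a * a + ((x * x) * 1# + (x * a + x * a))
    expand = solve 2 (λ a x → (a :+ x :* con 1) :* (a :+ x :* con 1) := a :* a :+ ((x :* x) :* con 1 :+ (x :* a :+ x :* a))) refl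
    regroup : ∀ p e a x → (p + (e + e)) + ((x * x) * 1# + (x * a + x * a)) ≈ (p + (x * x) * 1#) + ((e + x * a) + (e + x * a))
    regroup = solve 4 (λ p e a x → (p :+ (e :+ e)) :+ ((x :* x) :* con 1 :+ (x :* a :+ x :* a))
                                 := (p :+ (x :* x) :* con 1) :+ ((e :+ x :* a) :+ (e :+ x :* a))) refl

  square-minus-product : ∀ {a b c M₁ M₂ P₂ S₁ S₂ S₃} →
    b * b ≈ S₁ + c * a → b * c ≈ S₂ → c * c ≈ S₃ → M₁ * M₁ ≈ P₂ + (M₂ + M₂) →
    (b + c * M₁) * (b + c * M₁) - c * (a + b * M₁ + c * M₂) ≈ S₁ + M₁ * S₂ + (P₂ + M₂) * S₃
  square-minus-product {a} {b} {c} {M₁} {M₂} {P₂} {S₁} {S₂} {S₃} bb bc cc M₁M₁ = x≈y+z⇒x-z≈y (begin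
    (b + c * M₁) * (b + c * M₁)
      ≈⟨ expand b c M₁ ⟩
    b * b + (M₁ * (b * c) + M₁ * (b * c)) + (M₁ * M₁) * (c * c)
      ≈⟨ +-cong (+-cong bb (+-cong (*-congˡ bc) (*-congˡ bc))) (*-cong M₁M₁ cc) ⟩
    (S₁ + c * a) + (M₁ * S₂ + M₁ * S₂) + (P₂ + (M₂ + M₂)) * S₃
      ≈⟨ regroup S₁ S₂ S₃ c a M₁ M₂ P₂ ⟩
    (S₁ + M₁ * S₂ + (P₂ + M₂) * S₃) + (c * a + (M₁ * S₂ + M₂ * S₃))
      ≈⟨ +-congˡ (trans (distribute a b c M₁ M₂) (+-congˡ (+-cong (*-congˡ bc) (*-congˡ cc)))) ⟨
    (S₁ + M₁ * S₂ + (P₂ + M₂) * S₃) + c * (a + b * M₁ + c * M₂) ∎)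
    where
    x≈y+z⇒x-z≈y : ∀ {x y z} → x ≈ y + z → x - z ≈ y
    x≈y+z⇒x-z≈y {x} {y} {z} x≈y+z = begin
      x + - z         ≈⟨ +-congʳ x≈y+z ⟩
      y + z + - z     ≈⟨ +-assoc y z (- z) ⟩
      y + (z + - z)   ≈⟨ +-congˡ (-‿inverseʳ z) ⟩
      y + 0#          ≈⟨ +-identityʳ y ⟩
      y               ∎
    expand : ∀ b c M → (b + c * M) * (b + c * M) ≈ b * b + (M * (b * c) + M * (b * c)) + (M * M) * (c * c)
    expand = solve 3 (λ b c M → (b :+ c :* M) :* (b :+ c :* M) := b :* b :+ (M :* (b :* c) :+ M :* (b :* c)) :+ (M :* M) :* (c :* c)) refl
    regroup : ∀ S₁ S₂ S₃ c a M₁ M₂ P₂ →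
      (S₁ + c * a) + (M₁ * S₂ + M₁ * S₂) + (P₂ + (M₂ + M₂)) * S₃ ≈
      (S₁ + M₁ * S₂ + (P₂ + M₂) * S₃) + (c * a + (M₁ * S₂ + M₂ * S₃))
    regroup = solve 8 (λ S₁ S₂ S₃ c a M₁ M₂ P₂ →
      (S₁ :+ c :* a) :+ (M₁ :* S₂ :+ M₁ :* S₂) :+ (P₂ :+ (M₂ :+ M₂)) :* S₃
      := (S₁ :+ M₁ :* S₂ :+ (P₂ :+ M₂) :* S₃) :+ (c :* a :+ (M₁ :* S₂ :+ M₂ :* S₃))) refl
    distribute : ∀ a b c M₁ M₂ → c * (a + b * M₁ + c * M₂) ≈ c * a + (M₁ * (b * c) + M₂ * (c * c))
    distribute = solve 5 (λ a b c M₁ M₂ → c :* (a :+ b :* M₁ :+ c :* M₂) := c :* a :+ (M₁ :* (b :* c) :+ M₂ :* (c :* c))) refl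

module BasisEnumerator {c ℓ : Level} (R : CommutativeRing c ℓ) (E : ℕ) {ℓL a : ℕ}
  (yL : Fin ℓL → CommutativeRing.Carrier R) (ye yf : CommutativeRing.Carrier R)
  (yA : Fin a → CommutativeRing.Carrier R) where
  open CommutativeRing R hiding (zero)
  open Poly R
  open Poly.Matroid R (suc (suc E)) yL ye yf yA
  open SymmetricFunctions R
  open import Data.Nat using (_≡ᵇ_; _≤ᵇ_)
  open import Data.Bool using (Bool; true; false; _∧_; if_then_else_)
  open import Data.Bool.Properties using (∧-identityʳ; ∧-zeroʳ)
  open import Data.List using (map)
  open import Relation.Binary.PropositionalEquality as ≡ using (_≡_)
  open import Relation.Binary.Reasoning.Setoid setoid
  open import Algebra.Solver.Ring.NaturalCoefficients.Default commutativeSemiring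

  basisIndicator : Bool → Bool → ℕ → ℕ → Carrier
  basisIndicator be bf cL cA =
    fromBool (((cL N.+ bit be N.+ bit bf N.+ cA) ≡ᵇ suc (suc E)) ∧ ((cL N.+ bit be N.+ bit bf) ≤ᵇ 2))

  basesWith : Bool → Bool → ℕ → Carrier
  basesWith be bf cL = subsetSum yA (basisIndicator be bf cL)

  part-as-subsetSum : ∀ be bf → part be bf ≈ subsetSum yL (basesWith be bf)
  part-as-subsetSum be bf = trans (sumL-concatMap _ (allSubsets ℓL)) (sumL-map-cong (allSubsets ℓL) λ SL → begin
    sumL (map (λ SA → if isBasis (suc (suc E)) SL be bf SA then prodSub yL SL * prodSub yA SA else 0#) (allSubsets a))
      ≈⟨ sumL-map-cong (allSubsets a) (λ SA → trans (if-as-fromBool _ _) (swap _ (prodSub yL SL) _)) ⟩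
    sumL (map (λ SA → prodSub yL SL * (basisIndicator be bf (card SL) (card SA) * prodSub yA SA)) (allSubsets a))
      ≈⟨ sumL-map-*ˡ (prodSub yL SL) _ (allSubsets a) ⟩
    prodSub yL SL * basesWith be bf (card SL)
      ≈⟨ *-comm _ _ ⟩
    basesWith be bf (card SL) * prodSub yL SL ∎)
    where
    swap : ∀ b x y → b * (x * y) ≈ x * (b * y)
    swap = solve 3 (λ b x y → b :* (x :* y) := x :* (b :* y)) refl

  private
    select : ∀ t → subsetSum yA (λ cA → fromBool ((cA ≡ᵇ t) ∧ true)) ≈ esym t yA
    select t = trans (subsetSum-cong yA (λ cA → reflexive (≡.cong fromBool (∧-identityʳ (cA ≡ᵇ t)))))
                     (esym-as-subsetSum t yA)

    vanish : ∀ be bf cL → ((cL N.+ bit be N.+ bit bf) ≤ᵇ 2) ≡ false → basesWith be bf cL ≈ 0#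
    vanish be bf cL too-many = trans (subsetSum-cong yA λ cA → reflexive (≡.cong fromBool
        (≡.trans (≡.cong (((cL N.+ bit be N.+ bit bf N.+ cA) ≡ᵇ suc (suc E)) ∧_) too-many) (∧-zeroʳ _))))
      (subsetSum-0# yA)

    drop-zero : ∀ x y → x + 0# * y ≈ x
    drop-zero x y = trans (+-congˡ (zeroˡ y)) (+-identityʳ x)

  part-tf : part true false ≈ esym (suc E) yA + esym E yA * esym 1 yL
  part-tf = trans (part-as-subsetSum true false) (trans
    (subsetSum-≤2 yL (basesWith true false) (select (suc E)) (select E)
      (vanish true false 2 ≡.refl) (λ c → vanish true false (3 N.+ c) ≡.refl))
    (drop-zero _ _))

  part-ft : part false true ≈ esym (suc E) yA + esym E yA * esym 1 yL
  part-ft = trans (part-as-subsetSum false true) (trans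
    (subsetSum-≤2 yL (basesWith false true) (select (suc E)) (select E)
      (vanish false true 2 ≡.refl) (λ c → vanish false true (3 N.+ c) ≡.refl))
    (drop-zero _ _))

  part-tt : part true true ≈ esym E yA
  part-tt = trans (part-as-subsetSum true true) (trans
    (subsetSum-≤2 yL (basesWith true true) (select E)
      (vanish true true 1 ≡.refl) (vanish true true 2 ≡.refl) (λ c → vanish true true (3 N.+ c) ≡.refl))
    (trans (drop-zero _ _) (drop-zero _ _)))

  part-ff : part false false ≈ esym (2 N.+ E) yA + esym (suc E) yA * esym 1 yL + esym E yA * esym 2 yL
  part-ff = trans (part-as-subsetSum false false)
    (subsetSum-≤2 yL (basesWith false false) (select (2 N.+ E)) (select (suc E)) (select E)
      (λ c → vanish false false (3 N.+ c) ≡.refl))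

  ΔM-in-esym : ΔM ≈ (esym (suc E) yA + esym E yA * esym 1 yL) * (esym (suc E) yA + esym E yA * esym 1 yL)
                    - esym E yA * (esym (2 N.+ E) yA + esym (suc E) yA * esym 1 yL + esym E yA * esym 2 yL)
  ΔM-in-esym = +-cong (*-cong part-tf part-ft) (-‿cong (*-cong part-tt part-ff))

lemma3p1 : ∀ {c ℓr : Level} (R : CommutativeRing c ℓr) (r ℓ a : ℕ) →
  3 ≤ r → 1 ≤ ℓ → r ∸ 2 ≤ a →
  (yL : Fin ℓ → CommutativeRing.Carrier R) (ye yf : CommutativeRing.Carrier R)
  (yA : Fin a → CommutativeRing.Carrier R) →
  let open CommutativeRing R
      open Poly R
      open Poly.Matroid R r yL ye yf yA
      d = r ∸ 1
  in ΔM ≈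
       sumTo d (λ k → ι (catalan k) * mSym yA (2 N.* d) (d ∸ k))
     + m1 yL * sumFrom1To d (λ k → ι ((2 N.* k ∸ 1) C k) * mSym yA (2 N.* d ∸ 1) (d ∸ k))
     + (m2 yL + m11 yL) * sumTo (d ∸ 1) (λ k → ι ((2 N.* k) C k) * mSym yA (2 N.* d ∸ 2) (d ∸ 1 ∸ k))
lemma3p1 R (suc (suc E)) ℓ a (s≤s (s≤s _)) _ _ yL ye yf yA =
  trans ΔM-in-esym
  (trans (square-minus-product (esym-square-catalan yA E) (esym-consecutive yA E) (esym-square yA E) (esym₁-square yL))
         (+-cong (+-congˡ (*-congʳ (sym (subsets-of-size≈esym 1 yL))))
                 (*-congʳ (sym (+-cong (subsets-of-size≈esym 1 (λ p → yL p * yL p)) (subsets-of-size≈esym 2 yL))))))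
  where
  open CommutativeRing R
  open SymmetricFunctions R
  open BasisEnumerator R E yL ye yf yA
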